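{- Let $(G,*)$ be a groupoid satisfying the identities (i) $x(yz)\approx x(zy)$, (ii) $w(x(yz))\approx w((xy)z)$, (iii) $((wx)y)z\approx((wx)z)y$, (iv) $(w(xy))z\approx(w(xz))y$, (v) $v(w(x(yz)))\approx((v(wx))y)z$, (vi) $(vw)(x(yz))\approx(((vw)x)y)z$. Then $s_n(*)\le2$ and $s^{ac}_n(*)\le n^2$ for $n=3$, and $s_n(*)\le4$ and $s^{ac}_n(*)\le 2n^2$ for $n=4,5,\dots$. The upper bound for $s_n(*)$ is reached if the upper bound for $s^{ac}_n(*)$ is reached, and both upper bounds are reached by the 3-element groupoids $\mathrm{SC}3162$ (rows $0{:}\ 1\,1\,1$; $1{:}\ 0\,0\,0$; $2{:}\ 0\,0\,1$) and $\mathrm{SC}2467$ (rows $0{:}\ 1\,0\,0$; $1{:}\ 1\,0\,0$; $2{:}\ 1\,0\,1$).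
   Context: A groupoid $(G,*)$ is a set with a binary operation; $xy$ denotes $x*y$. $\mathcal B_n$ is the set of bracketings of the word $x_1x_2\cdots x_n$ (all ways to insert parentheses), and $\mathcal F_n$ is the set of full linear terms, obtained from bracketings by permuting the variables. Each such term $t$ induces an $n$-ary operation $t^*$ on $G$. The associative spectrum is $s_n(*):=|\{t^*:t\in\mathcal B_n\}|$ and the associative-commutative spectrum is $s^{ac}_n(*):=|\{t^*:t\in\mathcal F_n\}|$. A groupoid satisfies an identity if both sides take equal values under every assignment of elements of $G$ to the variables. A 3-element groupoid on $\{0,1,2\}$ is given by its Cayley table; "row $a{:}\ p\,q\,r$" means $a*0=p$, $a*1=q$, $a*2=r$. -}

module Defs where

open import Data.Nat using (ℕ; zero; suc; _*_; _≤_)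
open import Data.Fin using (Fin; zero; suc)
open import Data.List using (List; []; _∷_; _++_; length; allFin)
open import Data.List.Relation.Unary.All using (All)
open import Data.List.Relation.Unary.Any using (Any)
open import Data.List.Relation.Unary.AllPairs using (AllPairs)
open import Data.List.Relation.Binary.Permutation.Propositional using (_↭_)
open import Data.Product using (Σ; _×_; ∃)
open import Relation.Binary.PropositionalEquality using (_≡_)
open import Relation.Nullary using (¬_)

data Term (n : ℕ) : Set where
  var : Fin n → Term n
  _∙_ : Term n → Term n → Term n

leaves : ∀ {n} → Term n → List (Fin n)
leaves (var i) = i ∷ []
leaves (s ∙ t) = leaves s ++ leaves t

IsBracketing : (n : ℕ) → Term n → Set
IsBracketing n t = leaves t ≡ allFin n

IsFullLinear : (n : ℕ) → Term n → Set
IsFullLinear n t = leaves t ↭ allFin n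

⟦_⟧ : ∀ {n} {G : Set} → Term n → (G → G → G) → (Fin n → G) → G
⟦ var i ⟧ _*_ a = a i
⟦ s ∙ t ⟧ _*_ a = (⟦ s ⟧ _*_ a) * (⟦ t ⟧ _*_ a)

-- The set { t* : P t } has at most k elements.
AtMost : {G : Set} → (G → G → G) → (n : ℕ) → (Term n → Set) → ℕ → Set
AtMost {G} _*_ n P k =
  Σ (List ((Fin n → G) → G)) λ fs →
    length fs ≤ k ×
    (∀ t → P t → Any (λ f → ∀ a → ⟦ t ⟧ _*_ a ≡ f a) fs)

-- The set { t* : P t } has at least k elements.
AtLeast : {G : Set} → (G → G → G) → (n : ℕ) → (Term n → Set) → ℕ → Set
AtLeast {G} _*_ n P k =
  Σ (List (Term n)) λ ts →
    length ts ≡ k × All P ts ×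
    AllPairs (λ t u → ¬ (∀ a → ⟦ t ⟧ _*_ a ≡ ⟦ u ⟧ _*_ a)) ts

sAtMost sAtLeast acAtMost acAtLeast : {G : Set} → (G → G → G) → ℕ → ℕ → Set
sAtMost _*_ n k = AtMost _*_ n (IsBracketing n) k
sAtLeast _*_ n k = AtLeast _*_ n (IsBracketing n) k
acAtMost _*_ n k = AtMost _*_ n (IsFullLinear n) k
acAtLeast _*_ n k = AtLeast _*_ n (IsFullLinear n) k

Identities : (G : Set) → (G → G → G) → Set
Identities G _*_ =
  (∀ x y z → x * (y * z) ≡ x * (z * y)) ×
  (∀ w x y z → w * (x * (y * z)) ≡ w * ((x * y) * z)) ×
  (∀ w x y z → ((w * x) * y) * z ≡ ((w * x) * z) * y) ×
  (∀ w x y z → (w * (x * y)) * z ≡ (w * (x * z)) * y) ×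
  (∀ v w x y z → v * (w * (x * (y * z))) ≡ ((v * (w * x)) * y) * z) ×
  (∀ v w x y z → (v * w) * (x * (y * z)) ≡ (((v * w) * x) * y) * z)

-- The 3-element groupoids; "row a: p q r" means a*0=p, a*1=q, a*2=r.
sc3162 : Fin 3 → Fin 3 → Fin 3
sc3162 zero _ = suc zero
sc3162 (suc zero) _ = zero
sc3162 (suc (suc zero)) zero = zero
sc3162 (suc (suc zero)) (suc zero) = zero
sc3162 (suc (suc zero)) (suc (suc zero)) = suc zero

sc2467 : Fin 3 → Fin 3 → Fin 3
sc2467 _ zero = suc zero
sc2467 _ (suc zero) = zero
sc2467 zero (suc (suc zero)) = zero
sc2467 (suc zero) (suc (suc zero)) = zero
sc2467 (suc (suc zero)) (suc (suc zero)) = suc zero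

ReachesBounds : {G : Set} → (G → G → G) → Set
ReachesBounds _∘_ =
  (sAtMost _∘_ 3 2 × sAtLeast _∘_ 3 2 × acAtMost _∘_ 3 9 × acAtLeast _∘_ 3 9) ×
  (∀ n → 4 ≤ n →
    sAtMost _∘_ n 4 × sAtLeast _∘_ n 4 ×
    acAtMost _∘_ n (2 * (n * n)) × acAtLeast _∘_ n (2 * (n * n)))

-- Write a term as x r₁ ⋯ rₖ (applications nested to the left) and replace each argument
-- by its sequence of leaves. Identities (i) and (ii) turn each argument into a
-- right-normed product whose factors may be permuted, (v) and (vi) merge three
-- consecutive arguments into one, and (iii) and (iv) make what remains symmetric in the
-- variables after the head. So every term equals one of the four forms
-- x(c₁(c₂⋯)), (x(c₁c₂))(c₃⋯), (xy)(c₁⋯), ((xy)c₁)(c₂⋯), determined by the head x, the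
-- first argument y when it is a variable, and the parity of k: at most 4 operations for
-- a fixed order of the variables and 2n² in all (n² for n = 3, where only the first and
-- third forms exist). If the 2n² (n²) classes give distinct operations, so do the
-- bracketings, which lie in distinct classes. For SC3162 the classes are separated by
-- assignments into {0, 1, 2}: all zeros detect the parity, a single 1 the head, and two
-- 2s the first argument. SC2467 is the opposite groupoid, handled by mirroring terms.

module Submission where

open import Defs
open import Data.Nat using (ℕ; _*_; _≤_)
open import Data.Fin using (Fin)
open import Data.Product using (_×_; _,_)

open import Data.Bool using (if_then_else_)
open import Data.Fin using (zero; suc; punchOut; inject₁; opposite)
import Data.Fin as Fin
open import Data.Fin.Properties using (_≟_; all?; pigeonhole; punchOut-injective; inject₁-injective; *↔×)
open import Data.List using (List; []; _∷_; _++_; [_]; _∷ʳ_; length; map; foldl; filter; allFin; reverse; tabulate; lookup)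
open import Data.List.Properties
  using (++-assoc; ++-identityʳ; map-++; length-++; length-map; length-tabulate; foldl-∷ʳ; ∷-injective;
         reverse-++; reverse-involutive; filter-all; filter-accept; filter-reject)
open import Data.List.NonEmpty as List⁺ using (List⁺; _∷_; _⁺++⁺_; toList)
open import Data.List.Membership.Propositional using (_∈_; _∉_)
open import Data.List.Membership.Propositional.Properties
  using (∈-allFin; ∈-filter⁺; ∈-filter⁻; ∈-map⁺; ∈-tabulate⁺; ∈-lookup)
open import Data.List.Relation.Unary.All as All using (All; []; _∷_)
import Data.List.Relation.Unary.All.Properties as Allₚ
open import Data.List.Relation.Unary.AllPairs as AllPairs using (AllPairs; []; _∷_)
import Data.List.Relation.Unary.AllPairs.Properties as AllPairsₚ
open import Data.List.Relation.Unary.Any as Any using (Any; here; there; any?)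
open import Data.List.Relation.Unary.Unique.Propositional using (Unique)
open import Data.List.Relation.Unary.Unique.Propositional.Properties using (allFin⁺; filter⁺)
import Data.List.Relation.Binary.Permutation.Propositional as ↭
open import Data.List.Relation.Binary.Permutation.Propositional
  using (_↭_; prep; swap; ↭-refl; ↭-sym; ↭-trans; ↭-reflexive; module PermutationReasoning)
open import Data.List.Relation.Binary.Permutation.Propositional.Properties
  using (drop-∷; ∈-resp-↭; ↭-length; ∷↭∷ʳ; shift; map⁺; ↭-reverse)
open import Data.Nat using (zero; suc; _+_; _<_; z≤n; s≤s)
open import Data.Nat.Properties using (+-suc; suc-injective; ≤-refl; ≤-reflexive; ≤-pred; ≤-trans)
open import Data.Product using (proj₁; proj₂; ∃₂)
open import Data.Product.Function.NonDependent.Propositional using (_×-↔_)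
open import Data.Sum using (_⊎_; inj₁; inj₂)
open import Data.Unit using (tt)
open import Function.Base using (_∘_)
open import Function.Bundles using (Inverse; _↔_)
open import Function.Properties.Inverse using (↔-refl; ↔-trans)
open import Relation.Binary.PropositionalEquality
  using (_≡_; _≢_; refl; sym; trans; cong; cong₂; subst; module ≡-Reasoning)
open import Relation.Nullary using (¬_; ¬?; Dec; yes; no)
open import Relation.Nullary.Decidable using (⌊_⌋; toWitness)
open import Relation.Nullary.Negation using (contradiction)

variable
  n : ℕ

_≢?_ : (j x : Fin n) → Dec (j ≢ x)
j ≢? x = ¬? (j ≟ x)

infixl 6 _∖_
_∖_ : List (Fin n) → Fin n → List (Fin n)
xs ∖ x = filter (_≢? x) xs

↭-∷-∖ : ∀ {x : Fin n} {xs} → Unique xs → x ∈ xs → xs ↭ x ∷ xs ∖ x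
↭-∷-∖ {x = x} {.x ∷ ys} (x∉ys ∷ _) (here refl) = ↭-reflexive (cong (x ∷_) (begin
  ys                ≡⟨ filter-all (_≢? x) (All.map (λ x≢j j≡x → x≢j (sym j≡x)) x∉ys) ⟨
  ys ∖ x            ≡⟨ filter-reject (_≢? x) (λ x≢x → x≢x refl) ⟨
  (x ∷ ys) ∖ x      ∎))
  where open ≡-Reasoning
↭-∷-∖ {x = x} {z ∷ ys} (z∉ys ∷ u) (there x∈ys) = begin
  z ∷ ys            ↭⟨ prep z (↭-∷-∖ u x∈ys) ⟩
  z ∷ x ∷ ys ∖ x    ↭⟨ swap z x ↭-refl ⟩
  x ∷ z ∷ ys ∖ x    ≡⟨ cong (x ∷_) (filter-accept (_≢? x) (All.lookup z∉ys x∈ys)) ⟨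
  x ∷ (z ∷ ys) ∖ x  ∎
  where open PermutationReasoning

allFin-↭ : (x : Fin n) → allFin n ↭ x ∷ allFin n ∖ x
allFin-↭ x = ↭-∷-∖ (allFin⁺ _) (∈-allFin x)

allFin-↭₂ : {x y : Fin n} → x ≢ y → allFin n ↭ x ∷ y ∷ allFin n ∖ x ∖ y
allFin-↭₂ {x = x} {y} x≢y = ↭-trans (allFin-↭ x)
  (prep x (↭-∷-∖ (filter⁺ (_≢? x) (allFin⁺ _)) (∈-filter⁺ (_≢? x) (∈-allFin y) (x≢y ∘ sym))))

↭-allFin⁻ : ∀ {x : Fin n} {L} → x ∷ L ↭ allFin n → L ↭ allFin n ∖ x
↭-allFin⁻ {x = x} p = drop-∷ (↭-trans p (allFin-↭ x))

↭-allFin⁻₂ : ∀ {x y : Fin n} {L} → x ∷ y ∷ L ↭ allFin n → x ≢ y × L ↭ allFin n ∖ x ∖ y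
↭-allFin⁻₂ {x = x} {y} p =
  x≢y , drop-∷ (↭-trans (↭-allFin⁻ p) (↭-∷-∖ (filter⁺ (_≢? x) (allFin⁺ _)) y∈))
  where
  y∈ : y ∈ allFin _ ∖ x
  y∈ = ∈-resp-↭ (↭-allFin⁻ p) (here refl)
  x≢y : x ≢ y
  x≢y x≡y = proj₂ (∈-filter⁻ (_≢? x) {xs = allFin _} y∈) (sym x≡y)

head : Term n → Fin n
head (var i) = i
head (s ∙ t) = head s

leaves⁺ : Term n → List⁺ (Fin n)
leaves⁺ (var i) = List⁺.[ i ]
leaves⁺ (s ∙ t) = leaves⁺ s ⁺++⁺ leaves⁺ t

-- The arguments r₁, …, rₖ of t = (⋯((x r₁) r₂)⋯) rₖ, each replaced by its sequence of leaves.
blocks : Term n → List (List⁺ (Fin n))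
blocks (var i) = []
blocks (s ∙ t) = blocks s ∷ʳ leaves⁺ t

flatten : {A : Set} → List (List⁺ A) → List A
flatten [] = []
flatten (B ∷ Bs) = toList B ++ flatten Bs

flatten-∷ʳ : {A : Set} (Bs : List (List⁺ A)) (B : List⁺ A) → flatten (Bs ∷ʳ B) ≡ flatten Bs ++ toList B
flatten-∷ʳ [] B = ++-identityʳ (toList B)
flatten-∷ʳ (B′ ∷ Bs) B =
  trans (cong (toList B′ ++_) (flatten-∷ʳ Bs B)) (sym (++-assoc (toList B′) (flatten Bs) (toList B)))

flatten-map : {A B : Set} (f : A → B) (Bs : List (List⁺ A)) →
              flatten (map (List⁺.map f) Bs) ≡ map f (flatten Bs)
flatten-map f [] = refl
flatten-map f (B ∷ Bs) =
  trans (cong (map f (toList B) ++_) (flatten-map f Bs)) (sym (map-++ f (toList B) (flatten Bs)))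

toList-leaves⁺ : (t : Term n) → toList (leaves⁺ t) ≡ leaves t
toList-leaves⁺ (var i) = refl
toList-leaves⁺ (s ∙ t) = cong₂ _++_ (toList-leaves⁺ s) (toList-leaves⁺ t)

leaves-blocks : (t : Term n) → leaves t ≡ head t ∷ flatten (blocks t)
leaves-blocks (var i) = refl
leaves-blocks (s ∙ t) = begin
  leaves s ++ leaves t                               ≡⟨ cong₂ _++_ (leaves-blocks s) (sym (toList-leaves⁺ t)) ⟩
  head s ∷ flatten (blocks s) ++ toList (leaves⁺ t)  ≡⟨ cong (head s ∷_) (flatten-∷ʳ (blocks s) (leaves⁺ t)) ⟨
  head s ∷ flatten (blocks s ∷ʳ leaves⁺ t)           ∎
  where open ≡-Reasoning

data Ternary {n : ℕ} : Term n → Set where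
  x[yz] : ∀ x y z → Ternary (var x ∙ (var y ∙ var z))
  [xy]z : ∀ x y z → Ternary ((var x ∙ var y) ∙ var z)

ternary : (t : Term n) → length (leaves t) ≡ 3 → Ternary t
ternary t len = go t (suc-injective (trans (sym (length-leaves t)) len))
  where
  nodes : Term n → ℕ
  nodes (var _) = 0
  nodes (s ∙ t) = suc (nodes s + nodes t)
  length-leaves : (t : Term n) → length (leaves t) ≡ suc (nodes t)
  length-leaves (var _) = refl
  length-leaves (s ∙ t) =
    trans (length-++ (leaves s))
      (trans (cong₂ _+_ (length-leaves s) (length-leaves t)) (cong suc (+-suc (nodes s) (nodes t))))
  go : (t : Term n) → nodes t ≡ 2 → Ternary t
  go (var x ∙ (var y ∙ var z)) _ = x[yz] x y z
  go ((var x ∙ var y) ∙ var z) _ = [xy]z x y z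
  go (var _ ∙ var _) ()
  go (var _ ∙ (var _ ∙ (_ ∙ _))) ()
  go (var _ ∙ ((_ ∙ _) ∙ _)) ()
  go ((var _ ∙ var _) ∙ (_ ∙ _)) ()
  go ((var _ ∙ (_ ∙ _)) ∙ _) ()
  go (((_ ∙ _) ∙ _) ∙ _) ()

mirror : Term n → Term n
mirror (var i) = var i
mirror (s ∙ t) = mirror t ∙ mirror s

leaves-mirror : (t : Term n) → leaves (mirror t) ≡ reverse (leaves t)
leaves-mirror (var i) = refl
leaves-mirror (s ∙ t) =
  trans (cong₂ _++_ (leaves-mirror t) (leaves-mirror s)) (sym (reverse-++ (leaves s) (leaves t)))

⟦mirror⟧ : {G : Set} {_·_ _·ᵒᵖ_ : G → G → G} → (∀ x y → x ·ᵒᵖ y ≡ y · x) →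
           (t : Term n) (a : Fin n → G) → ⟦ mirror t ⟧ _·ᵒᵖ_ a ≡ ⟦ t ⟧ _·_ a
⟦mirror⟧ op (var i) a = refl
⟦mirror⟧ {_·_ = _·_} op (s ∙ t) a = trans (op _ _) (cong₂ _·_ (⟦mirror⟧ op s a) (⟦mirror⟧ op t a))

-- Normal forms and canonical terms

parity : ℕ → Fin 2
parity zero = zero
parity (suc zero) = suc zero
parity (suc (suc k)) = parity k

-- The shape of x r₁ ⋯ rₖ: whether r₁ is compound or a variable, and the parity of k.
-- The forms of nf below are A = compound 1: x(c₁(c₂⋯)), B = compound 0: (x(c₁c₂))(c₃⋯),
-- C = simple 0: (xy)(c₁⋯) and D = simple 1: ((xy)c₁)(c₂⋯).
data Kind : Set where
  compound simple : Fin 2 → Kind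

kind : {A : Set} → List (List⁺ A) → Kind
kind [] = compound zero
kind Bs@((_ ∷ []) ∷ _) = simple (parity (length Bs))
kind Bs@((_ ∷ _ ∷ _) ∷ _) = compound (parity (length Bs))

kind-map : {A B : Set} (f : A → B) (Bs : List (List⁺ A)) → kind (map (List⁺.map f) Bs) ≡ kind Bs
kind-map f [] = refl
kind-map f Bs@((_ ∷ []) ∷ _) = cong (λ k → simple (parity k)) (length-map (List⁺.map f) Bs)
kind-map f Bs@((_ ∷ _ ∷ _) ∷ _) = cong (λ k → compound (parity k)) (length-map (List⁺.map f) Bs)

-- The least number of variables after the head for which nf k is a term of kind k.
minArgs : Kind → ℕ
minArgs (compound zero) = 3
minArgs (compound (suc zero)) = 2
minArgs (simple zero) = 2
minArgs (simple (suc zero)) = 3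

minArgs≤3 : ∀ k → minArgs k ≤ 3
minArgs≤3 (compound zero) = ≤-refl
minArgs≤3 (compound (suc zero)) = s≤s (s≤s z≤n)
minArgs≤3 (simple zero) = s≤s (s≤s z≤n)
minArgs≤3 (simple (suc zero)) = ≤-refl

allKinds : List Kind
allKinds = compound zero ∷ compound (suc zero) ∷ simple zero ∷ simple (suc zero) ∷ []

∈-allKinds : ∀ k → k ∈ allKinds
∈-allKinds (compound zero) = here refl
∈-allKinds (compound (suc zero)) = there (here refl)
∈-allKinds (simple zero) = there (there (here refl))
∈-allKinds (simple (suc zero)) = there (there (there (here refl)))

module NormalForm {G : Set} (_·_ : G → G → G) where

  infixl 5 _⊲_ _⊲⁺_

  _⊲_ : G → List G → G
  w ⊲ [] = w
  w ⊲ (c ∷ cs) = w · (c ⊲ cs)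

  _⊲⁺_ : G → List⁺ G → G
  w ⊲⁺ B = w ⊲ toList B

  -- The last clause also covers the terms x and x y, of kinds compound 0 and simple 1.
  nf : Kind → G → List G → G
  nf (compound zero) x (c ∷ d ∷ cs) = (x · (c · d)) ⊲ cs
  nf (simple zero) x (y ∷ cs) = (x · y) ⊲ cs
  nf (simple (suc zero)) x (y ∷ c ∷ cs) = ((x · y) · c) ⊲ cs
  nf _ x cs = x ⊲ cs

  ⊲-++-⊲ : ∀ w L d ds → w ⊲ (L ++ [ d ⊲ ds ]) ≡ w ⊲ (L ++ d ∷ ds)
  ⊲-++-⊲ w [] d ds = refl
  ⊲-++-⊲ w (c ∷ cs) d ds = cong (w ·_) (⊲-++-⊲ c cs d ds)

module Tm {n : ℕ} = NormalForm (_∙_ {n})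

module _ {G : Set} {_·_ : G → G → G} where
  private
    module V = NormalForm _·_

  ⟦⊲⟧ : (w : Term n) (L : List (Fin n)) (a : Fin n → G) →
        ⟦ w Tm.⊲ map var L ⟧ _·_ a ≡ ⟦ w ⟧ _·_ a V.⊲ map a L
  ⟦⊲⟧ w [] a = refl
  ⟦⊲⟧ w (c ∷ cs) a = cong (⟦ w ⟧ _·_ a ·_) (⟦⊲⟧ (var c) cs a)

  ⟦nf⟧ : ∀ k (x : Fin n) L (a : Fin n → G) →
         ⟦ Tm.nf k (var x) (map var L) ⟧ _·_ a ≡ V.nf k (a x) (map a L)
  ⟦nf⟧ (compound zero) x (c ∷ d ∷ cs) a = ⟦⊲⟧ (var x ∙ (var c ∙ var d)) cs a
  ⟦nf⟧ (compound zero) x [] a = refl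
  ⟦nf⟧ (compound zero) x (c ∷ []) a = refl
  ⟦nf⟧ (compound (suc zero)) x L a = ⟦⊲⟧ (var x) L a
  ⟦nf⟧ (simple zero) x (y ∷ cs) a = ⟦⊲⟧ (var x ∙ var y) cs a
  ⟦nf⟧ (simple zero) x [] a = refl
  ⟦nf⟧ (simple (suc zero)) x (y ∷ c ∷ cs) a = ⟦⊲⟧ ((var x ∙ var y) ∙ var c) cs a
  ⟦nf⟧ (simple (suc zero)) x [] a = refl
  ⟦nf⟧ (simple (suc zero)) x (y ∷ []) a = refl

leaves-⊲ : (w : Term n) (L : List (Fin n)) → leaves (w Tm.⊲ map var L) ≡ leaves w ++ L
leaves-⊲ w [] = sym (++-identityʳ (leaves w))
leaves-⊲ w (c ∷ cs) = cong (leaves w ++_) (leaves-⊲ (var c) cs)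

leaves-nf : ∀ k (x : Fin n) L → minArgs k ≤ length L → leaves (Tm.nf k (var x) (map var L)) ≡ x ∷ L
leaves-nf (compound zero) x (c ∷ d ∷ cs) _ = leaves-⊲ (var x ∙ (var c ∙ var d)) cs
leaves-nf (compound (suc zero)) x L _ = leaves-⊲ (var x) L
leaves-nf (simple zero) x (y ∷ cs) _ = leaves-⊲ (var x ∙ var y) cs
leaves-nf (simple (suc zero)) x (y ∷ c ∷ cs) _ = leaves-⊲ ((var x ∙ var y) ∙ var c) cs
leaves-nf (compound zero) x [] ()
leaves-nf (compound zero) x (_ ∷ []) (s≤s ())
leaves-nf (simple zero) x [] ()
leaves-nf (simple (suc zero)) x [] ()
leaves-nf (simple (suc zero)) x (_ ∷ []) (s≤s ())

fourForms : Fin n → List (Fin n) → List (Term n)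
fourForms x xs = map (λ k → Tm.nf k (var x) (map var xs)) allKinds

fourForms-leaves : (x : Fin n) (xs : List (Fin n)) → 3 ≤ length xs →
                   All (λ t → leaves t ≡ x ∷ xs) (fourForms x xs)
fourForms-leaves x xs 3≤ =
  form (compound zero) ∷ form (compound (suc zero)) ∷ form (simple zero) ∷ form (simple (suc zero)) ∷ []
  where
  form : ∀ k → leaves (Tm.nf k (var x) (map var xs)) ≡ x ∷ xs
  form k = leaves-nf k x xs (≤-trans (minArgs≤3 k) 3≤)

-- (b , x , y) names the normal form with head x and parity b whose first
-- argument is the variable y, or is compound when y = x.
Class : ℕ → Set
Class n = Fin 2 × Fin n × Fin n

firstVar : Fin n → List (List⁺ (Fin n)) → Fin n
firstVar x ((y ∷ []) ∷ _) = y
firstVar x _ = x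

classOf : Fin n → List (List⁺ (Fin n)) → Class n
classOf x Bs = parity (length Bs) , x , firstVar x Bs

class : Term n → Class n
class t = classOf (head t) (blocks t)

kindOf : Class n → Kind
kindOf (b , x , y) with x ≟ y
... | yes _ = compound b
... | no _ = simple b

canon : Class n → Term n
canon {n} (b , x , y) with x ≟ y
... | yes _ = Tm.nf (compound b) (var x) (map var (allFin n ∖ x))
... | no _ = Tm.nf (simple b) (var x) (map var (y ∷ allFin n ∖ x ∖ y))

classes : Fin (2 * (n * n)) ↔ Class n
classes = ↔-trans *↔× (↔-refl ×-↔ *↔×)

length-∖ : (x : Fin n) → suc (length (allFin n ∖ x)) ≡ n
length-∖ {n} x = trans (sym (↭-length (allFin-↭ x))) (length-tabulate (λ i → i))

length-∖₂ : {x y : Fin n} → x ≢ y → suc (length (y ∷ allFin n ∖ x ∖ y)) ≡ n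
length-∖₂ {n} x≢y = trans (sym (↭-length (allFin-↭₂ x≢y))) (length-tabulate (λ i → i))

<⇒≤-length : ∀ {A : Set} (L : List A) {k} → suc (length L) ≡ n → minArgs k < n → minArgs k ≤ length L
<⇒≤-length _ len k<n = ≤-pred (subst (_ <_) (sym len) k<n)

canon-fullLinear : (c : Class n) → minArgs (kindOf c) < n → IsFullLinear n (canon c)
canon-fullLinear {n} (b , x , y) fits with x ≟ y
... | yes _ = ↭-trans (↭-reflexive (leaves-nf (compound b) x L (<⇒≤-length L (length-∖ x) fits))) (↭-sym (allFin-↭ x))
  where L = allFin n ∖ x
... | no x≢y = ↭-trans (↭-reflexive (leaves-nf (simple b) x L (<⇒≤-length L (length-∖₂ x≢y) fits))) (↭-sym (allFin-↭₂ x≢y))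
  where L = y ∷ allFin n ∖ x ∖ y

-- With three variables only the classes of x (y z) and (x y) z occur.
class₃ : Fin n × Fin n → Class n
class₃ (x , y) = (if ⌊ x ≟ y ⌋ then suc zero else zero) , x , y

class₃-diagonal : (x : Fin n) → class₃ (x , x) ≡ (suc zero , x , x)
class₃-diagonal x with x ≟ x
... | yes _ = refl
... | no x≢x = contradiction refl x≢x

class₃-off : {x y : Fin n} → x ≢ y → class₃ (x , y) ≡ (zero , x , y)
class₃-off {x = x} {y} x≢y with x ≟ y
... | yes x≡y = contradiction x≡y x≢y
... | no _ = refl

class₃-fits : (p : Fin n × Fin n) → minArgs (kindOf (class₃ p)) < 3
class₃-fits (x , y) with x ≟ y
... | yes _ = ≤-refl
... | no _ = ≤-refl

-- Reduction to normal form

module Normalisation {G : Set} (_·_ : G → G → G) (ids : Identities G _·_) where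

  open NormalForm _·_

  private
    eq-i : ∀ x y z → x · (y · z) ≡ x · (z · y)
    eq-i = proj₁ ids
    eq-ii : ∀ w x y z → w · (x · (y · z)) ≡ w · ((x · y) · z)
    eq-ii = proj₁ (proj₂ ids)
    eq-iii : ∀ w x y z → ((w · x) · y) · z ≡ ((w · x) · z) · y
    eq-iii = proj₁ (proj₂ (proj₂ ids))
    eq-iv : ∀ w x y z → (w · (x · y)) · z ≡ (w · (x · z)) · y
    eq-iv = proj₁ (proj₂ (proj₂ (proj₂ ids)))
    eq-v : ∀ v w x y z → v · (w · (x · (y · z))) ≡ ((v · (w · x)) · y) · z
    eq-v = proj₁ (proj₂ (proj₂ (proj₂ (proj₂ ids))))
    eq-vi : ∀ v w x y z → (v · w) · (x · (y · z)) ≡ (((v · w) · x) · y) · z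
    eq-vi = proj₂ (proj₂ (proj₂ (proj₂ (proj₂ ids))))

    ++-assoc₃ : {A : Set} (as bs cs ds : List A) → (as ++ bs ++ cs) ++ ds ≡ as ++ bs ++ cs ++ ds
    ++-assoc₃ as bs cs ds = trans (++-assoc as (bs ++ cs) ds) (cong (as ++_) (++-assoc bs cs ds))

  ⊲-swap : ∀ w x y L → w ⊲ (x ∷ y ∷ L) ≡ w ⊲ (y ∷ x ∷ L)
  ⊲-swap w x y [] = eq-i w x y
  ⊲-swap w x y (z ∷ zs) = begin
    w · (x · (y · S))  ≡⟨ cong (w ·_) (eq-i x y S) ⟩
    w · (x · (S · y))  ≡⟨ eq-ii w x S y ⟩
    w · ((x · S) · y)  ≡⟨ eq-i w (x · S) y ⟩
    w · (y · (x · S))  ∎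
    where
    open ≡-Reasoning
    S = z ⊲ zs

  ⊲-resp-↭ : ∀ {L L′} → L ↭ L′ → ∀ w → w ⊲ L ≡ w ⊲ L′
  ⊲-resp-↭ ↭.refl w = refl
  ⊲-resp-↭ (prep x p) w = cong (w ·_) (⊲-resp-↭ p x)
  ⊲-resp-↭ (swap {ys = ys} x y p) w = trans (cong (λ v → w · (x · v)) (⊲-resp-↭ p y)) (⊲-swap w x y ys)
  ⊲-resp-↭ (↭.trans p q) w = trans (⊲-resp-↭ p w) (⊲-resp-↭ q w)

  ⊲-snoc : ∀ w c cs z → w · ((c ⊲ cs) · z) ≡ w ⊲ (c ∷ (cs ∷ʳ z))
  ⊲-snoc w c [] z = refl
  ⊲-snoc w c (d ∷ ds) z = trans (sym (eq-ii w c (d ⊲ ds) z)) (cong (w ·_) (⊲-snoc c d ds z))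

  ⊲-merge : ∀ w c cs d ds → w · ((c ⊲ cs) · (d ⊲ ds)) ≡ w ⊲ (c ∷ cs ++ d ∷ ds)
  ⊲-merge w c cs d ds = trans (⊲-snoc w c cs (d ⊲ ds)) (⊲-++-⊲ w (c ∷ cs) d ds)

  ⊲-merge₃ : ∀ w c cs d ds e es → w · ((c ⊲ cs) · ((d ⊲ ds) · (e ⊲ es))) ≡ w ⊲ (c ∷ cs ++ d ∷ ds ++ e ∷ es)
  ⊲-merge₃ w c cs d ds e es =
    trans (cong (w ·_) (⊲-merge (c ⊲ cs) d ds e es)) (⊲-merge w c cs d (ds ++ e ∷ es))

  ⊲-pull : ∀ x h L e → x · ((h ⊲ L) · e) ≡ x · (h · (e ⊲ L))
  ⊲-pull x h L e = trans (⊲-snoc x h L e) (⊲-resp-↭ (prep h (↭-sym (∷↭∷ʳ e L))) x)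

  nfB-swap : ∀ x h d e L → (x · (h · d)) ⊲ (e ∷ L) ≡ (x · (h · e)) ⊲ (d ∷ L)
  nfB-swap x h d e L = begin
    (x · (h · d)) · (e ⊲ L)  ≡⟨ eq-iv x h d (e ⊲ L) ⟩
    (x · (h · (e ⊲ L))) · d  ≡⟨ cong (_· d) (⊲-pull x h L e) ⟨
    (x · ((h ⊲ L) · e)) · d  ≡⟨ eq-iv x (h ⊲ L) e d ⟩
    (x · ((h ⊲ L) · d)) · e  ≡⟨ cong (_· e) (⊲-pull x h L d) ⟩
    (x · (h · (d ⊲ L))) · e  ≡⟨ eq-iv x h (d ⊲ L) e ⟩
    (x · (h · e)) · (d ⊲ L)  ∎
    where open ≡-Reasoning

  nfB-resp-↭-tail : ∀ h {L L′} → L ↭ L′ → ∀ x → nf (compound zero) x (h ∷ L) ≡ nf (compound zero) x (h ∷ L′)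
  nfB-resp-↭-tail h ↭.refl x = refl
  nfB-resp-↭-tail h (prep d p) x = ⊲-resp-↭ p (x · (h · d))
  nfB-resp-↭-tail h (swap {xs = xs} d e p) x = trans (nfB-swap x h d e xs) (⊲-resp-↭ (prep d p) (x · (h · e)))
  nfB-resp-↭-tail h (↭.trans p q) x = trans (nfB-resp-↭-tail h p x) (nfB-resp-↭-tail h q x)

  nfB-resp-↭ : ∀ {L L′} → L ↭ L′ → ∀ x → nf (compound zero) x L ≡ nf (compound zero) x L′
  nfB-resp-↭ ↭.refl x = refl
  nfB-resp-↭ (prep h p) x = nfB-resp-↭-tail h p x
  nfB-resp-↭ (swap {ys = ys} c d p) x = trans (⊲-resp-↭ p (x · (c · d))) (cong (_⊲ ys) (eq-i x c d))
  nfB-resp-↭ (↭.trans p q) x = trans (nfB-resp-↭ p x) (nfB-resp-↭ q x)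

  nfD-swap : ∀ x y h k L → ((x · y) · h) ⊲ (k ∷ L) ≡ ((x · y) · k) ⊲ (h ∷ L)
  nfD-swap x y h k [] = eq-iii x y h k
  nfD-swap x y h k (z ∷ zs) = begin
    ((x · y) · h) · (k · S)  ≡⟨ eq-iii x y h (k · S) ⟩
    ((x · y) · (k · S)) · h  ≡⟨ eq-iv (x · y) k S h ⟩
    ((x · y) · (k · h)) · S  ≡⟨ cong (_· S) (eq-i (x · y) k h) ⟩
    ((x · y) · (h · k)) · S  ≡⟨ eq-iv (x · y) h S k ⟨
    ((x · y) · (h · S)) · k  ≡⟨ eq-iii x y k (h · S) ⟨
    ((x · y) · k) · (h · S)  ∎
    where
    open ≡-Reasoning
    S = z ⊲ zs

  nfD-resp-↭ : ∀ {L L′} → L ↭ L′ → ∀ x y → nf (simple (suc zero)) x (y ∷ L) ≡ nf (simple (suc zero)) x (y ∷ L′)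
  nfD-resp-↭ ↭.refl x y = refl
  nfD-resp-↭ (prep h p) x y = ⊲-resp-↭ p ((x · y) · h)
  nfD-resp-↭ (swap {xs = xs} h k p) x y = trans (nfD-swap x y h k xs) (⊲-resp-↭ (prep h p) ((x · y) · k))
  nfD-resp-↭ (↭.trans p q) x y = trans (nfD-resp-↭ p x y) (nfD-resp-↭ q x y)

  nf-compound-resp-↭ : ∀ b {L L′} → L ↭ L′ → ∀ x → nf (compound b) x L ≡ nf (compound b) x L′
  nf-compound-resp-↭ zero p x = nfB-resp-↭ p x
  nf-compound-resp-↭ (suc zero) p x = ⊲-resp-↭ p x

  nf-simple-resp-↭ : ∀ b {L L′} → L ↭ L′ → ∀ x y → nf (simple b) x (y ∷ L) ≡ nf (simple b) x (y ∷ L′)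
  nf-simple-resp-↭ zero p x y = ⊲-resp-↭ p (x · y)
  nf-simple-resp-↭ (suc zero) p x y = nfD-resp-↭ p x y

  ⊲-exchange : ∀ x c d ds e es → (x ⊲ (c ∷ ds ++ e ∷ es)) · d ≡ nf (compound zero) x (c ∷ d ∷ ds ++ e ∷ es)
  ⊲-exchange x c d [] e es = eq-iv x c (e ⊲ es) d
  ⊲-exchange x c d (f ∷ fs) e es = eq-iv x c (f ⊲ (fs ++ e ∷ es)) d

  compound-to-B : ∀ x c d ds e es → (x ⊲ (c ∷ d ∷ ds)) ⊲ (e ∷ es) ≡ nf (compound zero) x (c ∷ d ∷ ds ++ e ∷ es)
  compound-to-B x c d ds e es = begin
    (x · (c · (d ⊲ ds))) · (e ⊲ es)  ≡⟨ cong (_· (e ⊲ es)) (⊲-pull x c ds d) ⟨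
    (x · ((c ⊲ ds) · d)) · (e ⊲ es)  ≡⟨ eq-iv x (c ⊲ ds) d (e ⊲ es) ⟩
    (x · ((c ⊲ ds) · (e ⊲ es))) · d  ≡⟨ cong (_· d) (⊲-merge x c ds e es) ⟩
    (x ⊲ (c ∷ ds ++ e ∷ es)) · d     ≡⟨ ⊲-exchange x c d ds e es ⟩
    nf (compound zero) x (c ∷ d ∷ ds ++ e ∷ es)  ∎
    where open ≡-Reasoning

  simple-to-D : ∀ x y c cs e es → ((x · y) ⊲ (c ∷ cs)) ⊲ (e ∷ es) ≡ nf (simple (suc zero)) x (y ∷ c ∷ cs ++ e ∷ es)
  simple-to-D x y c [] e es = refl
  simple-to-D x y c (c′ ∷ cs) e es = begin
    ((x · y) · (c · (c′ ⊲ cs))) · (e ⊲ es)  ≡⟨ eq-iv (x · y) c (c′ ⊲ cs) (e ⊲ es) ⟩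
    ((x · y) · (c · (e ⊲ es))) · (c′ ⊲ cs)  ≡⟨ eq-iii x y (c · (e ⊲ es)) (c′ ⊲ cs) ⟩
    ((x · y) ⊲ (c′ ∷ cs)) ⊲ (c ∷ e ∷ es)    ≡⟨ simple-to-D x y c′ cs c (e ∷ es) ⟩
    nf (simple (suc zero)) x (y ∷ c′ ∷ cs ++ c ∷ e ∷ es)  ≡⟨ nfD-resp-↭ (shift c (c′ ∷ cs) (e ∷ es)) x y ⟩
    nf (simple (suc zero)) x (y ∷ c ∷ c′ ∷ cs ++ e ∷ es)  ∎
    where open ≡-Reasoning

  -- (v) and (vi) merge three arguments into one, so only the parity of their number matters.
  absorb-compound : ∀ x c d ds e es f fs →
                    ((x ⊲ (c ∷ d ∷ ds)) ⊲ (e ∷ es)) ⊲ (f ∷ fs) ≡ x ⊲ (c ∷ d ∷ ds ++ e ∷ es ++ f ∷ fs)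
  absorb-compound x c d ds e es f fs =
    trans (sym (eq-v x c (d ⊲ ds) (e ⊲ es) (f ⊲ fs))) (cong (x ·_) (⊲-merge₃ c d ds e es f fs))

  absorb-simple : ∀ x y c cs e es f fs →
                  (((x · y) ⊲ (c ∷ cs)) ⊲ (e ∷ es)) ⊲ (f ∷ fs) ≡ (x · y) ⊲ (c ∷ cs ++ e ∷ es ++ f ∷ fs)
  absorb-simple x y c cs e es f fs =
    trans (sym (eq-vi x y (c ⊲ cs) (e ⊲ es) (f ⊲ fs))) (⊲-merge₃ (x · y) c cs e es f fs)

  fold-compound : ∀ x c d ds R →
                  foldl _⊲⁺_ x ((c ∷ d ∷ ds) ∷ R) ≡ nf (compound (parity (suc (length R)))) x (c ∷ d ∷ ds ++ flatten R)
  fold-compound x c d ds [] = cong (λ L → x ⊲ (c ∷ d ∷ L)) (sym (++-identityʳ ds))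
  fold-compound x c d ds ((e ∷ es) ∷ []) =
    trans (compound-to-B x c d ds e es)
      (cong (λ L → nf (compound zero) x (c ∷ d ∷ ds ++ e ∷ L)) (sym (++-identityʳ es)))
  fold-compound x c d ds ((e ∷ es) ∷ (f ∷ fs) ∷ R) =
    trans (cong (λ w → foldl _⊲⁺_ w R) (absorb-compound x c d ds e es f fs))
      (trans (fold-compound x c d (ds ++ e ∷ es ++ f ∷ fs) R)
        (cong (λ L → nf (compound (parity (suc (length R)))) x (c ∷ d ∷ L)) (++-assoc₃ ds (e ∷ es) (f ∷ fs) (flatten R))))

  fold-simple : ∀ x y B R → foldl _⊲⁺_ (x · y) (B ∷ R) ≡ nf (simple (parity (length R))) x (y ∷ toList B ++ flatten R)
  fold-simple x y (c ∷ cs) [] = cong (λ L → (x · y) ⊲ (c ∷ L)) (sym (++-identityʳ cs))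
  fold-simple x y (c ∷ cs) ((e ∷ es) ∷ []) =
    trans (simple-to-D x y c cs e es)
      (cong (λ L → nf (simple (suc zero)) x (y ∷ c ∷ cs ++ e ∷ L)) (sym (++-identityʳ es)))
  fold-simple x y (c ∷ cs) ((e ∷ es) ∷ (f ∷ fs) ∷ R) =
    trans (cong (λ w → foldl _⊲⁺_ w R) (absorb-simple x y c cs e es f fs))
      (trans (fold-simple x y (c ∷ cs ++ e ∷ es ++ f ∷ fs) R)
        (cong (λ L → nf (simple (parity (length R))) x (y ∷ c ∷ L)) (++-assoc₃ cs (e ∷ es) (f ∷ fs) (flatten R))))

  fold-nf : ∀ x Bs → foldl _⊲⁺_ x Bs ≡ nf (kind Bs) x (flatten Bs)
  fold-nf x [] = refl
  fold-nf x ((y ∷ []) ∷ []) = refl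
  fold-nf x ((y ∷ []) ∷ B ∷ R) = fold-simple x y B R
  fold-nf x ((c ∷ d ∷ ds) ∷ R) = fold-compound x c d ds R

  module _ (a : Fin n → G) where

    ·-⟦⟧-· : ∀ p w c cs → w · (⟦ p ⟧ _·_ a · (c ⊲ cs)) ≡ w ⊲ (map a (toList (leaves⁺ p)) ++ c ∷ cs)
    ·-⟦⟧-· (var i) w c cs = refl
    ·-⟦⟧-· (p ∙ q) w c cs =
      trans (sym (eq-ii w (⟦ p ⟧ _·_ a) (⟦ q ⟧ _·_ a) (c ⊲ cs)))
        (trans (cong (w ·_) (·-⟦⟧-· q (⟦ p ⟧ _·_ a) c cs))
          (trans (·-⟦⟧-· p w (a (List⁺.head (leaves⁺ q))) (map a (List⁺.tail (leaves⁺ q)) ++ c ∷ cs))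
            (cong (w ⊲_) (sym (trans (cong (_++ c ∷ cs) (map-++ a (toList (leaves⁺ p)) (toList (leaves⁺ q))))
                                      (++-assoc (map a (toList (leaves⁺ p))) (map a (toList (leaves⁺ q))) (c ∷ cs)))))))

    ·-⟦⟧ : ∀ r w → w · ⟦ r ⟧ _·_ a ≡ w ⊲⁺ List⁺.map a (leaves⁺ r)
    ·-⟦⟧ (var i) w = refl
    ·-⟦⟧ (p ∙ q) w =
      trans (cong (w ·_) (·-⟦⟧ q (⟦ p ⟧ _·_ a)))
        (trans (·-⟦⟧-· p w (a (List⁺.head (leaves⁺ q))) (map a (List⁺.tail (leaves⁺ q))))
          (cong (w ⊲_) (sym (map-++ a (toList (leaves⁺ p)) (toList (leaves⁺ q))))))

    ⟦⟧-fold : ∀ t → ⟦ t ⟧ _·_ a ≡ foldl _⊲⁺_ (a (head t)) (map (List⁺.map a) (blocks t))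
    ⟦⟧-fold (var i) = refl
    ⟦⟧-fold (s ∙ t) = begin
      ⟦ s ⟧ _·_ a · ⟦ t ⟧ _·_ a             ≡⟨ cong (_· ⟦ t ⟧ _·_ a) (⟦⟧-fold s) ⟩
      F · ⟦ t ⟧ _·_ a                       ≡⟨ ·-⟦⟧ t F ⟩
      F ⊲⁺ List⁺.map a (leaves⁺ t)          ≡⟨ foldl-∷ʳ _⊲⁺_ (a (head s)) (List⁺.map a (leaves⁺ t)) Bs ⟨
      foldl _⊲⁺_ (a (head s)) (Bs ∷ʳ List⁺.map a (leaves⁺ t))
        ≡⟨ cong (foldl _⊲⁺_ (a (head s))) (map-++ (List⁺.map a) (blocks s) [ leaves⁺ t ]) ⟨
      foldl _⊲⁺_ (a (head s)) (map (List⁺.map a) (blocks s ∷ʳ leaves⁺ t))  ∎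
      where
      open ≡-Reasoning
      Bs = map (List⁺.map a) (blocks s)
      F = foldl _⊲⁺_ (a (head s)) Bs

    ⟦⟧-nf : ∀ t → ⟦ t ⟧ _·_ a ≡ nf (kind (blocks t)) (a (head t)) (map a (flatten (blocks t)))
    ⟦⟧-nf t = trans (⟦⟧-fold t) (trans (fold-nf (a (head t)) (map (List⁺.map a) (blocks t)))
      (cong₂ (λ k L → nf k (a (head t)) L) (kind-map a (blocks t)) (flatten-map a (blocks t))))

    ⟦canon⟧-compound : ∀ b {x : Fin n} {L} → x ∷ L ↭ allFin n →
                       ⟦ canon (b , x , x) ⟧ _·_ a ≡ nf (compound b) (a x) (map a L)
    ⟦canon⟧-compound b {x} p with x ≟ x
    ... | no x≢x = contradiction refl x≢x
    ... | yes _ = trans (⟦nf⟧ (compound b) x (allFin n ∖ x) a)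
                    (nf-compound-resp-↭ b (map⁺ a (↭-sym (↭-allFin⁻ p))) (a x))

    ⟦canon⟧-simple : ∀ b {x y : Fin n} {L} → x ∷ y ∷ L ↭ allFin n →
                     ⟦ canon (b , x , y) ⟧ _·_ a ≡ nf (simple b) (a x) (map a (y ∷ L))
    ⟦canon⟧-simple b {x} {y} p with x ≟ y
    ... | yes x≡y = contradiction x≡y (proj₁ (↭-allFin⁻₂ p))
    ... | no _ = trans (⟦nf⟧ (simple b) x (y ∷ allFin n ∖ x ∖ y) a)
                   (nf-simple-resp-↭ b (map⁺ a (↭-sym (proj₂ (↭-allFin⁻₂ p)))) (a x) (a y))

    ⟦canon-classOf⟧ : ∀ x Bs → x ∷ flatten Bs ↭ allFin n →
                      ⟦ canon (classOf x Bs) ⟧ _·_ a ≡ nf (kind Bs) (a x) (map a (flatten Bs))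
    ⟦canon-classOf⟧ x [] p = ⟦canon⟧-compound zero p
    ⟦canon-classOf⟧ x ((y ∷ []) ∷ R) p = ⟦canon⟧-simple _ p
    ⟦canon-classOf⟧ x ((c ∷ d ∷ ds) ∷ R) p = ⟦canon⟧-compound _ p

    ⟦⟧-canon-class : ∀ t → IsFullLinear n t → ⟦ t ⟧ _·_ a ≡ ⟦ canon (class t) ⟧ _·_ a
    ⟦⟧-canon-class t p =
      trans (⟦⟧-nf t) (sym (⟦canon-classOf⟧ (head t) (blocks t) (subst (_↭ allFin n) (leaves-blocks t) p)))

-- Counting term operations

allPairs-lookup : {A : Set} {R : A → A → Set} {xs : List A} → AllPairs R xs →
                  ∀ {i j : Fin (length xs)} → i Fin.< j → R (lookup xs i) (lookup xs j)
allPairs-lookup (px ∷ _) {zero} {suc j} _ = All.lookup px (∈-lookup j)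
allPairs-lookup (_ ∷ pxs) {suc i} {suc j} (s≤s i<j) = allPairs-lookup pxs i<j

allPairs-with : {A : Set} {P : A → Set} {R S : A → A → Set} {xs : List A} →
                (∀ {x y} → P x → P y → R x y → S x y) → All P xs → AllPairs R xs → AllPairs S xs
allPairs-with f [] [] = []
allPairs-with f (px ∷ pxs) (rs ∷ rss) =
  All.zipWith (λ (py , r) → f px py r) (pxs , rs) ∷ allPairs-with f pxs rss

module Counting {G : Set} (_·_ : G → G → G) {n : ℕ} where

  infix 4 _≃_
  _≃_ : Term n → Term n → Set
  s ≃ t = ∀ a → ⟦ s ⟧ _·_ a ≡ ⟦ t ⟧ _·_ a

  -- Merging the classes i and j would leave m − 1 classes for m pairwise distinct operations.
  collision : ∀ {m} {P : Term n → Set} (F : Fin m → (Fin n → G) → G) (c : Term n → Fin m) →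
              (∀ t → P t → ∀ a → ⟦ t ⟧ _·_ a ≡ F (c t) a) → AtLeast _·_ n P m →
              ∀ {i j} → i ≢ j → ¬ (∀ a → F i a ≡ F j a)
  collision {zero} _ _ _ _ {()}
  collision {suc m} {P} F c sound (ts , len , Pts , distinct) {i} {j} i≢j Fi≗Fj =
    clash (pigeonhole (subst (m <_) (sym len) ≤-refl) squeeze)
    where
    open ≡-Reasoning
    merge : Fin (suc m) → Fin (suc m)
    merge k with k ≟ j
    ... | yes _ = i
    ... | no _ = k
    merge≢ : ∀ k → j ≢ merge k
    merge≢ k with k ≟ j
    ... | yes _ = λ j≡i → i≢j (sym j≡i)
    ... | no k≢j = λ j≡k → k≢j (sym j≡k)
    F-merge : ∀ k a → F (merge k) a ≡ F k a
    F-merge k a with k ≟ j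
    ... | yes k≡j = trans (Fi≗Fj a) (cong (λ x → F x a) (sym k≡j))
    ... | no _ = refl
    squeeze : Fin (length ts) → Fin m
    squeeze p = punchOut (merge≢ (c (lookup ts p)))
    P-at : ∀ p → P (lookup ts p)
    P-at p = All.lookup Pts (∈-lookup p)
    clash : ¬ (∃₂ λ p q → p Fin.< q × squeeze p ≡ squeeze q)
    clash (p , q , p<q , same) = allPairs-lookup distinct p<q λ a → begin
      ⟦ lookup ts p ⟧ _·_ a          ≡⟨ sound _ (P-at p) a ⟩
      F (c (lookup ts p)) a          ≡⟨ F-merge _ a ⟨
      F (merge (c (lookup ts p))) a
        ≡⟨ cong (λ k → F k a) (punchOut-injective (merge≢ (c (lookup ts p))) (merge≢ (c (lookup ts q))) same) ⟩
      F (merge (c (lookup ts q))) a  ≡⟨ F-merge _ a ⟩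
      F (c (lookup ts q)) a          ≡⟨ sound _ (P-at q) a ⟨
      ⟦ lookup ts q ⟧ _·_ a          ∎

  module _ {K : Set} {P : Term n → Set} (E : K → (Fin n → G) → G) (cl : Term n → K)
           (sound : ∀ t → P t → ∀ a → ⟦ t ⟧ _·_ a ≡ E (cl t) a) where

    atMost-listed : ∀ {m} (ks : List K) → length ks ≤ m → (∀ t → P t → cl t ∈ ks) → AtMost _·_ n P m
    atMost-listed ks len listed = map E ks , subst (_≤ _) (sym (length-map E ks)) len ,
      λ t pt → Any.map (λ {f} E≡f a → trans (sound t pt a) (cong (λ g → g a) E≡f)) (∈-map⁺ E (listed t pt))

    module _ {m} (enum : Fin m ↔ K) where
      open Inverse enum

      atMost-enumerated : AtMost _·_ n P m
      atMost-enumerated = atMost-listed (tabulate to) (≤-reflexive (length-tabulate to))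
        (λ t _ → subst (_∈ tabulate to) (strictlyInverseˡ (cl t)) (∈-tabulate⁺ (from (cl t))))

      classification-injective : AtLeast _·_ n P m → ∀ {k l} → (∀ a → E k a ≡ E l a) → k ≡ l
      classification-injective atLeast {k} {l} Ek≗El with from k ≟ from l
      ... | yes eq = trans (sym (strictlyInverseˡ k)) (trans (cong to eq) (strictlyInverseˡ l))
      ... | no k≢l = contradiction (λ a → trans (E-to k a) (trans (Ek≗El a) (sym (E-to l a))))
                       (collision (λ i → E (to i)) (λ t → from (cl t))
                          (λ t pt a → trans (sound t pt a) (sym (E-to (cl t) a))) atLeast k≢l)
        where
        E-to : ∀ k a → E (to (from k)) a ≡ E k a
        E-to k a = cong (λ k′ → E k′ a) (strictlyInverseˡ k)

    atLeast-separated : (∀ {k l} → (∀ a → E k a ≡ E l a) → k ≡ l) → (ts : List (Term n)) → All P ts →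
                        AllPairs (λ s t → cl s ≢ cl t) ts → AtLeast _·_ n P (length ts)
    atLeast-separated E-injective ts Pts apart = ts , refl , Pts ,
      allPairs-with (λ ps pt cl≢ s≃t → cl≢ (E-injective λ a → trans (sym (sound _ ps a)) (trans (s≃t a) (sound _ pt a))))
        Pts apart

  atLeast-injective : ∀ {K : Set} {P : Term n → Set} {m} → Fin m ↔ K → (f : K → Term n) → (∀ k → P (f k)) →
                      (∀ {k l} → f k ≃ f l → k ≡ l) → AtLeast _·_ n P m
  atLeast-injective enum f Pf f-injective =
    tabulate (f ∘ to) , length-tabulate (f ∘ to) , Allₚ.tabulate⁺ (λ i → Pf (to i)) ,
    AllPairsₚ.tabulate⁺ (λ {i} {j} i≢j fi≃fj → i≢j (to-injective (f-injective fi≃fj)))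
    where
    open Inverse enum
    to-injective : ∀ {i j} → to i ≡ to j → i ≡ j
    to-injective {i} {j} eq = trans (sym (strictlyInverseʳ i)) (trans (cong from eq) (strictlyInverseʳ j))

module _ {G : Set} {_·_ _·′_ : G → G → G} (·′-opposite : ∀ x y → x ·′ y ≡ y · x)
         {P Q : Term n → Set} {m : ℕ} where

  atMost-mirror : (∀ t → P t → Q (mirror t)) → AtMost _·_ n Q m → AtMost _·′_ n P m
  atMost-mirror PQ (fs , len , covered) = fs , len , λ t pt →
    Any.map (λ same a → trans (sym (⟦mirror⟧ (λ x y → sym (·′-opposite y x)) t a)) (same a))
      (covered (mirror t) (PQ t pt))

  atLeast-mirror : (∀ t → Q t → P (mirror t)) → AtLeast _·_ n Q m → AtLeast _·′_ n P m
  atLeast-mirror QP (ts , len , Qts , distinct) =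
    map mirror ts , trans (length-map mirror ts) len , Allₚ.map⁺ (All.map (QP _) Qts) ,
    AllPairsₚ.map⁺ (AllPairs.map (λ {s} {t} s≄t same → s≄t (λ a →
      trans (sym (⟦mirror⟧ ·′-opposite s a)) (trans (same a) (⟦mirror⟧ ·′-opposite t a)))) distinct)

fullLinear-mirror : ∀ t → IsFullLinear n t → IsFullLinear n (mirror t)
fullLinear-mirror t p = ↭-trans (↭-reflexive (leaves-mirror t)) (↭-trans (↭-reverse (leaves t)) p)

bracketing-mirror : ∀ t → IsBracketing n t → leaves (mirror t) ≡ reverse (allFin n)
bracketing-mirror t lt = trans (leaves-mirror t) (cong reverse lt)

mirror-bracketing : ∀ t → leaves t ≡ reverse (allFin n) → IsBracketing n (mirror t)
mirror-bracketing {n} t lt = trans (leaves-mirror t) (trans (cong reverse lt) (reverse-involutive (allFin n)))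

bracketings-atMost₃ : {G : Set} (_·_ : G → G → G) (x y z : Fin n) →
                      AtMost _·_ n (λ t → leaves t ≡ x ∷ y ∷ z ∷ []) 2
bracketings-atMost₃ _·_ x y z = (x[yz]* ∷ [xy]z* ∷ []) , ≤-refl , covered
  where
  x[yz]* [xy]z* : (Fin _ → _) → _
  x[yz]* a = a x · (a y · a z)
  [xy]z* a = (a x · a y) · a z
  covered : ∀ t → leaves t ≡ x ∷ y ∷ z ∷ [] → Any (λ f → ∀ a → ⟦ t ⟧ _·_ a ≡ f a) (x[yz]* ∷ [xy]z* ∷ [])
  covered t lt with ternary t (cong length lt)
  ... | x[yz] _ _ _ with refl ← lt = here (λ a → refl)
  ... | [xy]z _ _ _ with refl ← lt = there (here (λ a → refl))

-- The bounds

module Bounds {G : Set} (_·_ : G → G → G) (ids : Identities G _·_) where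

  open NormalForm _·_ using (nf)
  open Normalisation _·_ ids
  open Counting _·_

  ac-atMost : acAtMost _·_ n (2 * (n * n))
  ac-atMost = atMost-enumerated (λ c a → ⟦ canon c ⟧ _·_ a) class (λ t p a → ⟦⟧-canon-class a t p) classes

  canon-separated : acAtLeast _·_ n (2 * (n * n)) →
                    ∀ {c c′} → (∀ a → ⟦ canon c ⟧ _·_ a ≡ ⟦ canon c′ ⟧ _·_ a) → c ≡ c′
  canon-separated = classification-injective (λ c a → ⟦ canon c ⟧ _·_ a) class (λ t p a → ⟦⟧-canon-class a t p) classes

  class₃-class : ∀ t → IsFullLinear 3 t → class₃ (proj₂ (class t)) ≡ class t
  class₃-class t p with ternary t (↭-length p)
  ... | x[yz] x _ _ = class₃-diagonal x
  ... | [xy]z _ _ _ = class₃-off (proj₁ (↭-allFin⁻₂ p))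

  ⟦⟧-canon-class₃ : ∀ t → IsFullLinear 3 t → ∀ a → ⟦ t ⟧ _·_ a ≡ ⟦ canon (class₃ (proj₂ (class t))) ⟧ _·_ a
  ⟦⟧-canon-class₃ t p a = trans (⟦⟧-canon-class a t p) (cong (λ c → ⟦ canon c ⟧ _·_ a) (sym (class₃-class t p)))

  ac-atMost₃ : acAtMost _·_ 3 9
  ac-atMost₃ = atMost-enumerated (λ p a → ⟦ canon (class₃ p) ⟧ _·_ a) (proj₂ ∘ class) ⟦⟧-canon-class₃ *↔×

  bracketings-atMost : (l : List (Fin n)) → AtMost _·_ n (λ t → leaves t ≡ l) 4
  bracketings-atMost [] = [] , z≤n , λ t lt → contradiction (trans (sym (leaves-blocks t)) lt) λ ()
  bracketings-atMost (x ∷ xs) =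
    atMost-listed (λ k a → nf k (a x) (map a xs)) (kind ∘ blocks) ⟦⟧-nf′ allKinds ≤-refl (λ t _ → ∈-allKinds _)
    where
    ⟦⟧-nf′ : ∀ t → leaves t ≡ x ∷ xs → ∀ a → ⟦ t ⟧ _·_ a ≡ nf (kind (blocks t)) (a x) (map a xs)
    ⟦⟧-nf′ t lt a = let head≡ , rest≡ = ∷-injective (trans (sym (leaves-blocks t)) lt) in
      trans (⟦⟧-nf a t) (cong₂ (λ y L → nf (kind (blocks t)) (a y) (map a L)) head≡ rest≡)

  bracketings-atLeast : ∀ {l} → l ↭ allFin n → 4 ≤ n → acAtLeast _·_ n (2 * (n * n)) →
                        AtLeast _·_ n (λ t → leaves t ≡ l) 4
  bracketings-atLeast {n} {l} p 4≤n ac =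
    go l (subst (4 ≤_) (trans (sym (length-tabulate (λ i → i))) (sym (↭-length p))) 4≤n) p
    where
    go : ∀ l → 4 ≤ length l → l ↭ allFin n → AtLeast _·_ n (λ t → leaves t ≡ l) 4
    go (x₀ ∷ x₁ ∷ x₂ ∷ x₃ ∷ r) _ p =
      atLeast-separated (λ c a → ⟦ canon c ⟧ _·_ a) class (λ t lt a → ⟦⟧-canon-class a t (subst (_↭ allFin n) (sym lt) p))
        (canon-separated ac) (fourForms x₀ (x₁ ∷ x₂ ∷ x₃ ∷ r)) (fourForms-leaves x₀ _ (s≤s (s≤s (s≤s z≤n))))
        (((λ ()) ∷ x₀≢x₁ ∘ cong (proj₂ ∘ proj₂) ∷ (λ ()) ∷ []) ∷
         ((λ ()) ∷ x₀≢x₁ ∘ cong (proj₂ ∘ proj₂) ∷ []) ∷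
         ((λ ()) ∷ []) ∷ [] ∷ [])
      where
      x₀≢x₁ : x₀ ≢ x₁
      x₀≢x₁ = proj₁ (↭-allFin⁻₂ p)
    go [] () _
    go (_ ∷ []) (s≤s ()) _
    go (_ ∷ _ ∷ []) (s≤s (s≤s ())) _
    go (_ ∷ _ ∷ _ ∷ []) (s≤s (s≤s (s≤s ()))) _

  bracketings-atLeast₃ : ∀ {x y z} → x ∷ y ∷ z ∷ [] ↭ allFin 3 → acAtLeast _·_ 3 9 →
                         AtLeast _·_ 3 (λ t → leaves t ≡ x ∷ y ∷ z ∷ []) 2
  bracketings-atLeast₃ {x} {y} {z} p ac₃ =
    atLeast-separated E₃ (proj₂ ∘ class) (λ t lt → ⟦⟧-canon-class₃ t (subst (_↭ allFin 3) (sym lt) p))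
      (classification-injective E₃ (proj₂ ∘ class) ⟦⟧-canon-class₃ *↔× ac₃)
      (var x ∙ (var y ∙ var z) ∷ (var x ∙ var y) ∙ var z ∷ []) (refl ∷ refl ∷ [])
      ((proj₁ (↭-allFin⁻₂ p) ∘ cong proj₂ ∷ []) ∷ [] ∷ [])
    where
    E₃ : Fin 3 × Fin 3 → (Fin 3 → G) → G
    E₃ q a = ⟦ canon (class₃ q) ⟧ _·_ a

  bounds : (sAtMost _·_ 3 2 × acAtMost _·_ 3 9 × (acAtLeast _·_ 3 9 → sAtLeast _·_ 3 2)) ×
           (∀ n → 4 ≤ n → sAtMost _·_ n 4 × acAtMost _·_ n (2 * (n * n)) ×
                          (acAtLeast _·_ n (2 * (n * n)) → sAtLeast _·_ n 4))
  bounds = (bracketings-atMost₃ _·_ zero (suc zero) (suc (suc zero)) , ac-atMost₃ , bracketings-atLeast₃ ↭-refl) ,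
           λ n 4≤n → bracketings-atMost (allFin n) , ac-atMost , bracketings-atLeast ↭-refl 4≤n

  reachesBounds : acAtLeast _·_ 3 9 → (∀ n → 4 ≤ n → acAtLeast _·_ n (2 * (n * n))) → ReachesBounds _·_
  reachesBounds ac₃ ac =
    (bracketings-atMost₃ _·_ zero (suc zero) (suc (suc zero)) , bracketings-atLeast₃ ↭-refl ac₃ , ac-atMost₃ , ac₃) ,
    λ n 4≤n → bracketings-atMost (allFin n) , bracketings-atLeast ↭-refl 4≤n (ac n 4≤n) , ac-atMost , ac n 4≤n

  reachesBounds-opposite : {_·′_ : G → G → G} → (∀ x y → x ·′ y ≡ y · x) →
                           acAtLeast _·_ 3 9 → (∀ n → 4 ≤ n → acAtLeast _·_ n (2 * (n * n))) → ReachesBounds _·′_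
  reachesBounds-opposite {_·′_} op ac₃ ac =
    (bracketings-atMost₃ _·′_ zero (suc zero) (suc (suc zero)) ,
     atLeast-mirror op mirror-bracketing (bracketings-atLeast₃ (↭-reverse (allFin 3)) ac₃) ,
     atMost-mirror op fullLinear-mirror ac-atMost₃ ,
     atLeast-mirror op fullLinear-mirror ac₃) ,
    λ n 4≤n → atMost-mirror op bracketing-mirror (bracketings-atMost (reverse (allFin n))) ,
              atLeast-mirror op mirror-bracketing (bracketings-atLeast (↭-reverse (allFin n)) 4≤n (ac n 4≤n)) ,
              atMost-mirror op fullLinear-mirror ac-atMost ,
              atLeast-mirror op fullLinear-mirror (ac n 4≤n)

-- SC3162 and SC2467

identities-sc3162 : Identities (Fin 3) sc3162
identities-sc3162 =
  (λ x y z → toWitness {a? = all? λ x → all? λ y → all? λ z → x · (y · z) ≟ x · (z · y)} tt x y z) ,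
  (λ w x y z → toWitness {a? = all? λ w → all? λ x → all? λ y → all? λ z →
     w · (x · (y · z)) ≟ w · ((x · y) · z)} tt w x y z) ,
  (λ w x y z → toWitness {a? = all? λ w → all? λ x → all? λ y → all? λ z →
     ((w · x) · y) · z ≟ ((w · x) · z) · y} tt w x y z) ,
  (λ w x y z → toWitness {a? = all? λ w → all? λ x → all? λ y → all? λ z →
     (w · (x · y)) · z ≟ (w · (x · z)) · y} tt w x y z) ,
  (λ v w x y z → toWitness {a? = all? λ v → all? λ w → all? λ x → all? λ y → all? λ z →
     v · (w · (x · (y · z))) ≟ ((v · (w · x)) · y) · z} tt v w x y z) ,
  (λ v w x y z → toWitness {a? = all? λ v → all? λ w → all? λ x → all? λ y → all? λ z →
     (v · w) · (x · (y · z)) ≟ (((v · w) · x) · y) · z} tt v w x y z)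
  where
  _·_ : Fin 3 → Fin 3 → Fin 3
  _·_ = sc3162

sc2467-opposite : ∀ x y → sc2467 x y ≡ sc3162 y x
sc2467-opposite x y = toWitness {a? = all? λ x → all? λ y → sc2467 x y ≟ sc3162 y x} tt x y

flip : Fin 3 → Fin 3
flip zero = suc zero
flip (suc _) = zero

-- Every product of sc3162 lies in {0, 1}, where rows 0 and 1 are the constants 1 and 0.
sc3162-flipˡ : ∀ x z → sc3162 (flip x) z ≡ flip (flip x)
sc3162-flipˡ zero z = refl
sc3162-flipˡ (suc _) z = refl

sc3162-·ˡ : ∀ x y z → sc3162 (sc3162 x y) z ≡ flip (sc3162 x y)
sc3162-·ˡ zero y z = refl
sc3162-·ˡ (suc zero) y z = refl
sc3162-·ˡ (suc (suc zero)) zero z = refl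
sc3162-·ˡ (suc (suc zero)) (suc zero) z = refl
sc3162-·ˡ (suc (suc zero)) (suc (suc zero)) z = refl

sc3162-·ʳ : ∀ w x y → sc3162 w (sc3162 x y) ≡ flip w
sc3162-·ʳ zero x y = refl
sc3162-·ʳ (suc zero) x y = refl
sc3162-·ʳ (suc (suc zero)) zero y = refl
sc3162-·ʳ (suc (suc zero)) (suc zero) y = refl
sc3162-·ʳ (suc (suc zero)) (suc (suc zero)) zero = refl
sc3162-·ʳ (suc (suc zero)) (suc (suc zero)) (suc zero) = refl
sc3162-·ʳ (suc (suc zero)) (suc (suc zero)) (suc (suc zero)) = refl

private
  module S = NormalForm sc3162

formValue : Kind → Fin 3 → Fin 3 → Fin 3
formValue (compound zero) x _ = flip (flip x)
formValue (compound (suc zero)) x _ = flip x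
formValue (simple zero) x y = flip (sc3162 x y)
formValue (simple (suc zero)) x y = flip (flip (sc3162 x y))

nf-compound-sc3162 : ∀ b x L → minArgs (compound b) ≤ length L → S.nf (compound b) x L ≡ formValue (compound b) x x
nf-compound-sc3162 zero x (c ∷ d ∷ e ∷ cs) _ =
  trans (cong (λ v → sc3162 v (e S.⊲ cs)) (sc3162-·ʳ x c d)) (sc3162-flipˡ x (e S.⊲ cs))
nf-compound-sc3162 (suc zero) x (c ∷ d ∷ cs) _ = sc3162-·ʳ x c (d S.⊲ cs)
nf-compound-sc3162 zero x [] ()
nf-compound-sc3162 zero x (_ ∷ []) (s≤s ())
nf-compound-sc3162 zero x (_ ∷ _ ∷ []) (s≤s (s≤s ()))
nf-compound-sc3162 (suc zero) x [] ()
nf-compound-sc3162 (suc zero) x (_ ∷ []) (s≤s ())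

nf-simple-sc3162 : ∀ b x y L → minArgs (simple b) ≤ length (y ∷ L) → S.nf (simple b) x (y ∷ L) ≡ formValue (simple b) x y
nf-simple-sc3162 zero x y (c ∷ cs) _ = sc3162-·ˡ x y (c S.⊲ cs)
nf-simple-sc3162 (suc zero) x y (c ∷ d ∷ cs) _ =
  trans (cong (λ v → sc3162 v (d S.⊲ cs)) (sc3162-·ˡ x y c)) (sc3162-flipˡ (sc3162 x y) (d S.⊲ cs))
nf-simple-sc3162 zero x y [] (s≤s ())
nf-simple-sc3162 (suc zero) x y [] (s≤s ())
nf-simple-sc3162 (suc zero) x y (_ ∷ []) (s≤s (s≤s ()))

observe : Class n → (Fin n → Fin 3) → Fin 3
observe (b , x , y) a = formValue (kindOf (b , x , y)) (a x) (a y)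

⟦canon⟧-sc3162 : (c : Class n) → minArgs (kindOf c) < n → ∀ a → ⟦ canon c ⟧ sc3162 a ≡ observe c a
⟦canon⟧-sc3162 {n} (b , x , y) fits a with x ≟ y
... | yes refl = trans (⟦nf⟧ (compound b) x L a)
                   (nf-compound-sc3162 b (a x) _ (subst (minArgs (compound b) ≤_) (sym (length-map a L)) (<⇒≤-length L (length-∖ x) fits)))
  where L = allFin n ∖ x
... | no x≢y = trans (⟦nf⟧ (simple b) x (y ∷ L) a)
                 (nf-simple-sc3162 b (a x) (a y) _ (subst (minArgs (simple b) ≤_) (sym (length-map a (y ∷ L)))
                   (<⇒≤-length (y ∷ L) (length-∖₂ x≢y) fits)))
  where L = allFin n ∖ x ∖ y

parityOf : Kind → Fin 2
parityOf (compound b) = b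
parityOf (simple b) = b

parityOf-kindOf : (c : Class n) → parityOf (kindOf c) ≡ proj₁ c
parityOf-kindOf (b , x , y) with x ≟ y
... | yes _ = refl
... | no _ = refl

formValue-0 : ∀ k y → formValue k zero y ≡ inject₁ (parityOf k)
formValue-0 (compound zero) y = refl
formValue-0 (compound (suc zero)) y = refl
formValue-0 (simple zero) y = refl
formValue-0 (simple (suc zero)) y = refl

formValue-1 : ∀ k y → formValue k (suc zero) y ≡ inject₁ (opposite (parityOf k))
formValue-1 (compound zero) y = refl
formValue-1 (compound (suc zero)) y = refl
formValue-1 (simple zero) y = refl
formValue-1 (simple (suc zero)) y = refl

inject₁≢opposite : (b : Fin 2) → inject₁ b ≢ inject₁ (opposite b)
inject₁≢opposite zero ()
inject₁≢opposite (suc zero) ()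

observe-0 : (c : Class n) (a : Fin n → Fin 3) → a (proj₁ (proj₂ c)) ≡ zero → observe c a ≡ inject₁ (proj₁ c)
observe-0 c@(b , x , y) a ax≡0 = begin
  formValue (kindOf c) (a x) (a y)   ≡⟨ cong (λ v → formValue (kindOf c) v (a y)) ax≡0 ⟩
  formValue (kindOf c) zero (a y)    ≡⟨ formValue-0 (kindOf c) (a y) ⟩
  inject₁ (parityOf (kindOf c))      ≡⟨ cong inject₁ (parityOf-kindOf c) ⟩
  inject₁ b                          ∎
  where open ≡-Reasoning

observe-1 : (c : Class n) (a : Fin n → Fin 3) → a (proj₁ (proj₂ c)) ≡ suc zero →
            observe c a ≡ inject₁ (opposite (proj₁ c))
observe-1 c@(b , x , y) a ax≡1 = begin
  formValue (kindOf c) (a x) (a y)         ≡⟨ cong (λ v → formValue (kindOf c) v (a y)) ax≡1 ⟩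
  formValue (kindOf c) (suc zero) (a y)    ≡⟨ formValue-1 (kindOf c) (a y) ⟩
  inject₁ (opposite (parityOf (kindOf c))) ≡⟨ cong (inject₁ ∘ opposite) (parityOf-kindOf c) ⟩
  inject₁ (opposite b)                     ∎
  where open ≡-Reasoning

observe-2-2 : ∀ b {x y : Fin n} a → x ≢ y → a x ≡ suc (suc zero) → a y ≡ suc (suc zero) →
              observe (b , x , y) a ≡ inject₁ b
observe-2-2 b {x} {y} a x≢y ax≡2 ay≡2 with x ≟ y
... | yes x≡y = contradiction x≡y x≢y
... | no _ = trans (cong₂ (formValue (simple b)) ax≡2 ay≡2) (value b)
  where
  value : ∀ b → formValue (simple b) (suc (suc zero)) (suc (suc zero)) ≡ inject₁ b
  value zero = refl
  value (suc zero) = refl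

observe-2-0 : ∀ b {x y : Fin n} a → a x ≡ suc (suc zero) → x ≡ y ⊎ a y ≡ zero →
              observe (b , x , y) a ≡ inject₁ (opposite b)
observe-2-0 b {x} {y} a ax≡2 x≡y⊎ay≡0 with x ≟ y | x≡y⊎ay≡0
... | yes _ | _ = trans (cong (λ v → formValue (compound b) v (a y)) ax≡2) (value b)
  where
  value : ∀ b → formValue (compound b) (suc (suc zero)) (a y) ≡ inject₁ (opposite b)
  value zero = refl
  value (suc zero) = refl
... | no x≢y | inj₁ x≡y = contradiction x≡y x≢y
... | no _ | inj₂ ay≡0 = trans (cong₂ (formValue (simple b)) ax≡2 ay≡0) (value b)
  where
  value : ∀ b → formValue (simple b) (suc (suc zero)) zero ≡ inject₁ (opposite b)
  value zero = refl
  value (suc zero) = refl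

mark : List (Fin n) → Fin 3 → Fin n → Fin 3
mark xs v i with any? (i ≟_) xs
... | yes _ = v
... | no _ = zero

mark-∈ : ∀ {xs : List (Fin n)} {v i} → i ∈ xs → mark xs v i ≡ v
mark-∈ {xs = xs} {i = i} i∈xs with any? (i ≟_) xs
... | yes _ = refl
... | no i∉xs = contradiction i∈xs i∉xs

mark-∉ : ∀ {xs : List (Fin n)} {v i} → i ∉ xs → mark xs v i ≡ zero
mark-∉ {xs = xs} {i = i} i∉xs with any? (i ≟_) xs
... | yes i∈xs = contradiction i∈xs i∉xs
... | no _ = refl

observe-parity : ∀ {b b′} {x x′ y y′ : Fin n} → (∀ a → observe (b , x , y) a ≡ observe (b′ , x′ , y′) a) → b ≡ b′
observe-parity {b = b} {b′} {x} {x′} {y} {y′} same = inject₁-injective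
  (trans (sym (observe-0 (b , x , y) zeros refl)) (trans (same zeros) (observe-0 (b′ , x′ , y′) zeros refl)))
  where
  zeros = λ _ → zero

observe-head : ∀ {b} {x x′ y y′ : Fin n} → (∀ a → observe (b , x , y) a ≡ observe (b , x′ , y′) a) → x ≡ x′
observe-head {b = b} {x} {x′} {y} {y′} same with x ≟ x′
... | yes x≡x′ = x≡x′
... | no x≢x′ = contradiction
  (trans (sym (observe-0 (b , x , y) a (mark-∉ {xs = [ x′ ]} λ { (here x≡x′) → x≢x′ x≡x′ })))
    (trans (same a) (observe-1 (b , x′ , y′) a (mark-∈ (here refl)))))
  (inject₁≢opposite b)
  where a = mark [ x′ ] (suc zero)

observe-first : ∀ {b} {x y y′ : Fin n} → (∀ a → observe (b , x , y) a ≡ observe (b , x , y′) a) → y ≡ y′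
observe-first {b = b} {x} {y} {y′} same with y ≟ y′
... | yes y≡y′ = y≡y′
... | no y≢y′ = contradiction refl (separate (x ≟ y))
  where
  separate : Dec (x ≡ y) → inject₁ b ≢ inject₁ b
  separate (no x≢y) _ = inject₁≢opposite b
    (trans (sym (observe-2-2 b a x≢y (mark-∈ (here refl)) (mark-∈ (there (here refl)))))
      (trans (same a) (observe-2-0 b a (mark-∈ (here refl)) y′-unmarked)))
    where
    a = mark (x ∷ y ∷ []) (suc (suc zero))
    y′-unmarked : x ≡ y′ ⊎ a y′ ≡ zero
    y′-unmarked with x ≟ y′
    ... | yes x≡y′ = inj₁ x≡y′
    ... | no x≢y′ = inj₂ (mark-∉ {xs = x ∷ y ∷ []}
      λ { (here y′≡x) → x≢y′ (sym y′≡x) ; (there (here y′≡y)) → y≢y′ (sym y′≡y) })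
  separate (yes x≡y) _ = inject₁≢opposite b
    (trans (sym (observe-2-2 b a x≢y′ (mark-∈ (here refl)) (mark-∈ (there (here refl)))))
      (trans (sym (same a)) (observe-2-0 b a (mark-∈ (here refl)) (inj₁ x≡y))))
    where
    a = mark (x ∷ y′ ∷ []) (suc (suc zero))
    x≢y′ : x ≢ y′
    x≢y′ x≡y′ = y≢y′ (trans (sym x≡y) x≡y′)

observe-injective : {c c′ : Class n} → (∀ a → observe c a ≡ observe c′ a) → c ≡ c′
observe-injective {c = b , x , y} {b′ , x′ , y′} same
  with observe-parity {b = b} {b′} {x} {x′} {y} {y′} same
... | refl with observe-head {b = b} {x} {x′} {y} {y′} same
... | refl with observe-first {b = b} {x} {y} {y′} same
... | refl = refl

canon-injective-sc3162 : {c c′ : Class n} → minArgs (kindOf c) < n → minArgs (kindOf c′) < n →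
                         (∀ a → ⟦ canon c ⟧ sc3162 a ≡ ⟦ canon c′ ⟧ sc3162 a) → c ≡ c′
canon-injective-sc3162 {c = c} {c′} fits fits′ same =
  observe-injective (λ a → trans (sym (⟦canon⟧-sc3162 c fits a)) (trans (same a) (⟦canon⟧-sc3162 c′ fits′ a)))

canonical-atLeast-sc3162 : ∀ {K : Set} {m} → Fin m ↔ K → (f : K → Class n) → (∀ k → minArgs (kindOf (f k)) < n) →
                           (∀ {k l} → f k ≡ f l → k ≡ l) → acAtLeast sc3162 n m
canonical-atLeast-sc3162 enum f fits f-injective =
  atLeast-injective enum (canon ∘ f) (λ k → canon-fullLinear (f k) (fits k))
    (λ same → f-injective (canon-injective-sc3162 (fits _) (fits _) same))
  where open Counting sc3162

acAtLeast₃-sc3162 : acAtLeast sc3162 3 9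
acAtLeast₃-sc3162 = canonical-atLeast-sc3162 *↔× class₃ class₃-fits (cong proj₂)

acAtLeast-sc3162 : ∀ n → 4 ≤ n → acAtLeast sc3162 n (2 * (n * n))
acAtLeast-sc3162 n 4≤n =
  canonical-atLeast-sc3162 classes (λ c → c) (λ c → ≤-trans (s≤s (minArgs≤3 (kindOf c))) 4≤n) (λ c≡c′ → c≡c′)

theorem3p6 : ((G : Set) (_∘_ : G → G → G) → Identities G _∘_ →
    (sAtMost _∘_ 3 2 × acAtMost _∘_ 3 9 ×
    (acAtLeast _∘_ 3 9 → sAtLeast _∘_ 3 2)) ×
    (∀ n → 4 ≤ n →
    sAtMost _∘_ n 4 × acAtMost _∘_ n (2 * (n * n)) ×
    (acAtLeast _∘_ n (2 * (n * n)) → sAtLeast _∘_ n 4))) ×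
    ReachesBounds sc3162 × ReachesBounds sc2467
theorem3p6 =
  (λ G _∘_ ids → Bounds.bounds _∘_ ids) ,
  Bounds.reachesBounds sc3162 identities-sc3162 acAtLeast₃-sc3162 acAtLeast-sc3162 ,
  Bounds.reachesBounds-opposite sc3162 identities-sc3162 sc2467-opposite acAtLeast₃-sc3162 acAtLeast-sc3162
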